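{- Let $s$ be any nonnegative integer. If $b$ is an integer satisfying $b \geq s+2$ and $b \geq (s+1)^{2s+2}/(s+1)!$, then $\tau_s(s+2,b) \geq \lfloor ((s+1)!\,b)^{1/(2s+2)} \rfloor - s-1$.
   Context: All graphs are finite and simple. For graphs $G,H$ on disjoint vertex sets, the join $G \vee H$ is the graph consisting of $G$, $H$, and all edges joining a vertex of $G$ to a vertex of $H$; $K_n$ is the complete graph on $n$ vertices, and $K_0 \vee G$ is understood as $G$. $K_{a,b}$ is the complete bipartite graph with partite sets of sizes $a$ and $b$. $\chi$ denotes chromatic number and $\chi_\ell$ list chromatic number. For a nonnegative integer $s$ and positive integers $a \le b$, $\tau_s(a,b)$ denotes the smallest nonnegative integer $n$ such that $\chi_\ell(K_n \vee K_{a,b}) - \chi(K_n \vee K_{a,b}) \leq s$. -}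

module Defs where

open import Data.Nat using (ℕ; _+_; _*_; _^_; _≤_; _<_; suc)
open import Data.Fin using (Fin)
open import Data.Sum using (_⊎_; inj₁; inj₂)
open import Data.Product using (Σ; _×_; ∃; ∃-syntax)
open import Data.Unit using (⊤)
open import Data.Empty using (⊥)
open import Data.List using (List; length)
open import Data.List.Relation.Unary.Unique.Propositional using (Unique)
open import Data.List.Membership.Propositional using (_∈_)
open import Relation.Nullary using (¬_)
open import Relation.Binary.PropositionalEquality using (_≡_; _≢_)

record Graph : Set₁ where
  field
    V      : Set
    Adj    : V → V → Set
    sym    : ∀ {u v} → Adj u v → Adj v u
    irrefl : ∀ {v} → ¬ Adj v v
open Graph public

K : ℕ → Graph
K n = record { V = Fin n ; Adj = λ x y → x ≢ y
             ; sym = λ p q → p (Relation.Binary.PropositionalEquality.sym q)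
             ; irrefl = λ p → p Relation.Binary.PropositionalEquality.refl }

KBAdj : (a b : ℕ) → Fin a ⊎ Fin b → Fin a ⊎ Fin b → Set
KBAdj a b (inj₁ _) (inj₁ _) = ⊥
KBAdj a b (inj₁ _) (inj₂ _) = ⊤
KBAdj a b (inj₂ _) (inj₁ _) = ⊤
KBAdj a b (inj₂ _) (inj₂ _) = ⊥

KB-sym : (a b : ℕ) → ∀ {u v} → KBAdj a b u v → KBAdj a b v u
KB-sym a b {inj₁ _} {inj₂ _} p = p
KB-sym a b {inj₂ _} {inj₁ _} p = p

KB-irrefl : (a b : ℕ) → ∀ {v} → ¬ KBAdj a b v v
KB-irrefl a b {inj₁ _} ()
KB-irrefl a b {inj₂ _} ()

KBip : ℕ → ℕ → Graph
KBip a b = record { V = Fin a ⊎ Fin b ; Adj = KBAdj a b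
                  ; sym = λ {u} {v} → KB-sym a b {u} {v} ; irrefl = λ {v} → KB-irrefl a b {v} }

JoinAdj : (G H : Graph) → V G ⊎ V H → V G ⊎ V H → Set
JoinAdj G H (inj₁ x) (inj₁ y) = Adj G x y
JoinAdj G H (inj₁ _) (inj₂ _) = ⊤
JoinAdj G H (inj₂ _) (inj₁ _) = ⊤
JoinAdj G H (inj₂ x) (inj₂ y) = Adj H x y

Join-sym : (G H : Graph) → ∀ {u v} → JoinAdj G H u v → JoinAdj G H v u
Join-sym G H {inj₁ _} {inj₁ _} p = sym G p
Join-sym G H {inj₁ _} {inj₂ _} p = p
Join-sym G H {inj₂ _} {inj₁ _} p = p
Join-sym G H {inj₂ _} {inj₂ _} p = sym H p

Join-irrefl : (G H : Graph) → ∀ {v} → ¬ JoinAdj G H v v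
Join-irrefl G H {inj₁ _} p = irrefl G p
Join-irrefl G H {inj₂ _} p = irrefl H p

_∨G_ : Graph → Graph → Graph
G ∨G H = record { V = V G ⊎ V H ; Adj = JoinAdj G H
                ; sym = λ {u} {v} → Join-sym G H {u} {v} ; irrefl = λ {v} → Join-irrefl G H {v} }

Proper : (G : Graph) {C : Set} → (V G → C) → Set
Proper G c = ∀ u v → Adj G u v → c u ≢ c v

Colorable : Graph → ℕ → Set
Colorable G k = Σ (V G → Fin k) (Proper G)

IsChromaticNumber : Graph → ℕ → Set
IsChromaticNumber G k = Colorable G k × (∀ j → j < k → ¬ Colorable G j)

Choosable : Graph → ℕ → Set
Choosable G k =
  (L : V G → List ℕ) → (∀ v → Unique (L v)) → (∀ v → length (L v) ≡ k) →
  Σ (V G → ℕ) (λ c → (∀ v → c v ∈ L v) × Proper G c)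

IsListChromaticNumber : Graph → ℕ → Set
IsListChromaticNumber G k = Choosable G k × (∀ j → j < k → ¬ Choosable G j)

GapAtMost : Graph → ℕ → Set
GapAtMost G s = ∃[ kl ] ∃[ k ]
  (IsListChromaticNumber G kl × IsChromaticNumber G k × kl ≤ k + s)

-- τ_s(a,b) = t : t is the least n with χ_ℓ(K_n ∨ K_{a,b}) - χ(K_n ∨ K_{a,b}) ≤ s
IsTau : ℕ → ℕ → ℕ → ℕ → Set
IsTau s a b t = GapAtMost (K t ∨G KBip a b) s
              × (∀ n → n < t → ¬ GapAtMost (K n ∨G KBip a b) s)

IsFloorRoot : ℕ → ℕ → ℕ → Set
IsFloorRoot k x r = r ^ k ≤ x × x < suc r ^ k

{-# OPTIONS --safe #-}
module Submission where

-- Let N = t + s + 2 and suppose r ∸ s ∸ 1 > t, so that N ≤ r and hence N ^ (2s+2) ≤ (s+1)! b.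
-- Since K_t ∨ K_{s+2,b} is (t+2)-colourable, χ_ℓ − χ ≤ s would make it N-choosable. It is not:
-- give K_t and one vertex a₀ of the small side the palette S = {0, …, N−1}, the other s+1 small
-- vertices pairwise disjoint palettes T₁, …, T_{s+1} of size N disjoint from S, and let the big
-- side run through all lists D ∪ {x₁, …, x_{s+1}} with D a (t+1)-subset of S and xᵢ ∈ Tᵢ. There
-- are C(N, s+1) N^(s+1) ≤ N^(2s+2) / (s+1)! ≤ b such lists. In a colouring from these lists the
-- clique K_t + a₀ uses a (t+1)-subset D of S, the small vertices use some xᵢ ∈ Tᵢ, and the big
-- vertex carrying D ∪ {x₁, …, x_{s+1}} is adjacent to all of them.

open import Defs hiding (sym)
open import Data.Nat using (ℕ; _+_; _*_; _^_; _≤_; _∸_; _!)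
open import Data.Nat using (zero; suc; _<_; z≤n; s≤s⁻¹; NonZero)
open import Data.Nat.Properties
open import Data.Nat.Combinatorics using (_C_; nCk+nC[k+1]≡[n+1]C[k+1]; nCk≡nC[n∸k])
open import Data.Nat.DivMod using (_/_; +-distrib-/-∣ˡ; m*n/n≡m; m<n⇒m/n≡0)
open import Data.Nat.Divisibility using (n∣m*n)
open import Data.Nat.Solver using (module +-*-Solver)
open import Data.Fin as Fin using (Fin; toℕ; join; splitAt; inject≤)
open import Data.Fin.Properties using (splitAt-join; any?; injective⇒≤; toℕ-inject≤; toℕ-injective)
open import Data.List
  using (List; []; _∷_; _++_; map; length; lookup; take; filter; applyUpTo; tabulate; cartesianProductWith)
open import Data.List.Properties using (length-++; length-map; length-take; length-applyUpTo; length-tabulate)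
open import Data.List.Membership.Propositional using (_∈_; _∉_)
open import Data.List.Membership.Propositional.Properties
  using (∈-map⁺; ∈-map⁻; ∈-++⁺ˡ; ∈-++⁺ʳ; ∈-++⁻; ∈-filter⁺; ∈-filter⁻; ∈-tabulate⁻; ∈-applyUpTo⁻;
         ∈-cartesianProductWith⁺; ∈-cartesianProductWith⁻)
open import Data.List.Relation.Unary.Any using (here; there; index)
open import Data.List.Relation.Unary.Any.Properties using (lookup-index)
open import Data.List.Relation.Unary.All as All using (All; []; _∷_)
import Data.List.Relation.Unary.All.Properties as Allₚ
open import Data.List.Relation.Unary.AllPairs using (AllPairs; []; _∷_)
import Data.List.Relation.Unary.AllPairs.Properties as AllPairsₚ
open import Data.List.Relation.Unary.Unique.Propositional using (Unique)
import Data.List.Relation.Unary.Unique.Propositional.Properties as Unique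
open import Data.List.Relation.Binary.Disjoint.Propositional using (Disjoint)
open import Data.List.Relation.Binary.Pointwise as Pointwise using (Pointwise; []; _∷_; Pointwise-length)
open import Data.List.Relation.Binary.Sublist.Propositional as Sublist
  using (_⊆_; []; _∷_; _∷ʳ_; ⊆-trans; minimum)
open import Data.List.Relation.Binary.Sublist.Propositional.Properties using (take-⊆; filter-⊆)
open import Data.Sum using (_⊎_; inj₁; inj₂)
import Data.Sum as Sum
open import Data.Sum.Properties using (inj₁-injective; inj₂-injective)
open import Data.Product using (Σ; _×_; _,_; proj₁; proj₂; ∃)
open import Data.Unit using (tt)
open import Function using (_∘_; id)
open import Function.Definitions using (Injective)
open import Relation.Nullary using (¬_; contradiction)
open import Relation.Nullary.Decidable using (decidable-stable)
open import Relation.Unary using (Decidable)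
open import Relation.Binary.Definitions using (DecidableEquality)
open import Relation.Binary.PropositionalEquality
  using (_≡_; _≢_; refl; sym; trans; cong; cong₂; subst; subst₂; module ≡-Reasoning)

private
  variable
    A B : Set
    x : A
    xs ys : List A
    xss : List (List A)

n^[1+k]+[1+k]*n^k≤[1+n]^[1+k] : ∀ n k → n ^ suc k + suc k * n ^ k ≤ suc n ^ suc k
n^[1+k]+[1+k]*n^k≤[1+n]^[1+k] n zero    = ≤-reflexive (+-comm (n * 1) 1)
n^[1+k]+[1+k]*n^k≤[1+n]^[1+k] n (suc k) = begin
    n * (n * p) + (2 + k) * (n * p)                 ≤⟨ m≤m+n _ ((1 + k) * p) ⟩
    n * (n * p) + (2 + k) * (n * p) + (1 + k) * p   ≡⟨ solve 3 (λ n p k →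
      n :* (n :* p) :+ (con 2 :+ k) :* (n :* p) :+ (con 1 :+ k) :* p
        := (con 1 :+ n) :* (n :* p :+ (con 1 :+ k) :* p)) refl n p k ⟩
    suc n * (n * p + (1 + k) * p)                   ≤⟨ *-monoʳ-≤ (suc n) (n^[1+k]+[1+k]*n^k≤[1+n]^[1+k] n k) ⟩
    suc n ^ suc (suc k)                             ∎
  where
  open ≤-Reasoning
  open +-*-Solver
  p : ℕ
  p = n ^ k

nCk*k!≤n^k : ∀ n k → (n C k) * k ! ≤ n ^ k
nCk*k!≤n^k n       zero    = ≤-refl
nCk*k!≤n^k zero    (suc k) = z≤n
nCk*k!≤n^k (suc n) (suc k) = begin
    (suc n C suc k) * suc k !                         ≡⟨ cong (_* suc k !) (nCk+nC[k+1]≡[n+1]C[k+1] n k) ⟨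
    (n C k + n C suc k) * (suc k * k !)               ≡⟨ solve 4 (λ a c k f →
      (a :+ c) :* ((con 1 :+ k) :* f) := (con 1 :+ k) :* (a :* f) :+ c :* ((con 1 :+ k) :* f))
      refl (n C k) (n C suc k) k (k !) ⟩
    suc k * ((n C k) * k !) + (n C suc k) * suc k !   ≤⟨ +-mono-≤ (*-monoʳ-≤ (suc k) (nCk*k!≤n^k n k))
                                                                  (nCk*k!≤n^k n (suc k)) ⟩
    suc k * n ^ k + n ^ suc k                         ≡⟨ +-comm (suc k * n ^ k) (n ^ suc k) ⟩
    n ^ suc k + suc k * n ^ k                         ≤⟨ n^[1+k]+[1+k]*n^k≤[1+n]^[1+k] n k ⟩
    suc n ^ suc k                                     ∎
  where
  open ≤-Reasoning
  open +-*-Solver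

n^[k+k]≤k!*b⇒nCk*n^k≤b : ∀ n k b → n ^ (k + k) ≤ k ! * b → (n C k) * n ^ k ≤ b
n^[k+k]≤k!*b⇒nCk*n^k≤b n k b n^[k+k]≤k!*b = *-cancelˡ-≤ (k !) {{k !≢0}} (begin
    k ! * ((n C k) * n ^ k)   ≡⟨ solve 3 (λ f c p → f :* (c :* p) := c :* f :* p) refl (k !) (n C k) (n ^ k) ⟩
    (n C k) * k ! * n ^ k     ≤⟨ *-monoˡ-≤ (n ^ k) (nCk*k!≤n^k n k) ⟩
    n ^ k * n ^ k             ≡⟨ ^-distribˡ-+-* n k k ⟨
    n ^ (k + k)               ≤⟨ n^[k+k]≤k!*b ⟩
    k ! * b                   ∎)
  where
  open ≤-Reasoning
  open +-*-Solver

combinations : ℕ → List A → List (List A)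
combinations zero    xs       = [] ∷ []
combinations (suc k) []       = []
combinations (suc k) (x ∷ xs) = map (x ∷_) (combinations k xs) ++ combinations (suc k) xs

length-combinations : ∀ k (xs : List A) → length (combinations k xs) ≡ length xs C k
length-combinations zero    xs       = refl
length-combinations (suc k) []       = refl
length-combinations (suc k) (x ∷ xs) = begin
    length (map (x ∷_) (combinations k xs) ++ combinations (suc k) xs)
  ≡⟨ length-++ (map (x ∷_) (combinations k xs)) ⟩
    length (map (x ∷_) (combinations k xs)) + length (combinations (suc k) xs)
  ≡⟨ cong₂ _+_ (trans (length-map (x ∷_) (combinations k xs)) (length-combinations k xs))
               (length-combinations (suc k) xs) ⟩
    length xs C k + length xs C suc k
  ≡⟨ nCk+nC[k+1]≡[n+1]C[k+1] (length xs) k ⟩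
    suc (length xs) C suc k
  ∎
  where open ≡-Reasoning

∈-combinations⁺ : ys ⊆ xs → ys ∈ combinations (length ys) xs
∈-combinations⁺                [] = here refl
∈-combinations⁺ {ys = []}      (_ ∷ʳ _) = here refl
∈-combinations⁺ {ys = _ ∷ _}   (x ∷ʳ τ) = ∈-++⁺ʳ _ (∈-combinations⁺ τ)
∈-combinations⁺                (refl ∷ τ) = ∈-++⁺ˡ (∈-map⁺ _ (∈-combinations⁺ τ))

∈-combinations⁻ : ∀ k (xs : List A) → ys ∈ combinations k xs → ys ⊆ xs × length ys ≡ k
∈-combinations⁻ zero xs (here refl) = minimum xs , refl
∈-combinations⁻ (suc k) (x ∷ xs) ys∈ with ∈-++⁻ (map (x ∷_) (combinations k xs)) ys∈
... | inj₁ ys∈map with ys′ , ys′∈ , refl ← ∈-map⁻ (x ∷_) ys∈map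
                  with τ , len ← ∈-combinations⁻ k xs ys′∈ = refl ∷ τ , cong suc len
... | inj₂ ys∈rest with τ , len ← ∈-combinations⁻ (suc k) xs ys∈rest = x ∷ʳ τ , len

length-cartesianProductWith : ∀ {C : Set} (f : A → B → C) xs ys →
  length (cartesianProductWith f xs ys) ≡ length xs * length ys
length-cartesianProductWith f []       ys = refl
length-cartesianProductWith f (x ∷ xs) ys = begin
    length (map (f x) ys ++ cartesianProductWith f xs ys)
  ≡⟨ length-++ (map (f x) ys) ⟩
    length (map (f x) ys) + length (cartesianProductWith f xs ys)
  ≡⟨ cong₂ _+_ (length-map (f x) ys) (length-cartesianProductWith f xs ys) ⟩
    length ys + length xs * length ys
  ∎
  where open ≡-Reasoning

choices : List (List A) → List (List A)
choices []         = [] ∷ []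
choices (xs ∷ xss) = cartesianProductWith _∷_ xs (choices xss)

∈-choices⁺ : Pointwise _∈_ ys xss → ys ∈ choices xss
∈-choices⁺ []           = here refl
∈-choices⁺ (y∈xs ∷ ys∈) = ∈-cartesianProductWith⁺ _∷_ y∈xs (∈-choices⁺ ys∈)

∈-choices⁻ : ∀ (xss : List (List A)) → ys ∈ choices xss → Pointwise _∈_ ys xss
∈-choices⁻ []         (here refl) = []
∈-choices⁻ (xs ∷ xss) ys∈
  with _ , _ , y∈xs , ys∈ , refl ← ∈-cartesianProductWith⁻ _∷_ xs (choices xss) ys∈
  = y∈xs ∷ ∈-choices⁻ xss ys∈

length-choices : ∀ {n} → All (λ xs → length xs ≡ n) xss → length (choices xss) ≡ n ^ length xss
length-choices []                         = refl
length-choices {xss = xs ∷ xss} (len ∷ lens) =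
  trans (length-cartesianProductWith _∷_ xs (choices xss)) (cong₂ _*_ len (length-choices lens))

Pointwise-∈⇒All-∉ : Pointwise _∈_ ys xss → All (Disjoint xs) xss → All (_∉ xs) ys
Pointwise-∈⇒All-∉ []           []       = []
Pointwise-∈⇒All-∉ (y∈ ∷ ys∈) (disj ∷ disjs) = (λ y∈xs → disj (y∈xs , y∈)) ∷ Pointwise-∈⇒All-∉ ys∈ disjs

Pointwise-∈⇒Unique : Pointwise _∈_ ys xss → AllPairs Disjoint xss → Unique ys
Pointwise-∈⇒Unique []         []             = []
Pointwise-∈⇒Unique (y∈ ∷ ys∈) (disjs ∷ disjss) =
  All.map (λ y′∉ y≡y′ → y′∉ (subst (_∈ _) y≡y′ y∈)) (Pointwise-∈⇒All-∉ ys∈ disjs)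
  ∷ Pointwise-∈⇒Unique ys∈ disjss

Unique-anti-mono : xs ⊆ ys → Unique ys → Unique xs
Unique-anti-mono []         []         = []
Unique-anti-mono (_ ∷ʳ τ)   (_ ∷ u)    = Unique-anti-mono τ u
Unique-anti-mono (refl ∷ τ) (x∉ ∷ u)   = Allₚ.anti-mono (Sublist.lookup τ) x∉ ∷ Unique-anti-mono τ u

injective⇒≤length : ∀ {k} {f : Fin k → A} → Injective _≡_ _≡_ f → (∀ i → f i ∈ xs) → k ≤ length xs
injective⇒≤length {xs = xs} {f = f} f-injective f∈ = injective⇒≤ index-injective
  where
  index-injective : Injective _≡_ _≡_ (λ i → index (f∈ i))
  index-injective {i} {j} same-index = f-injective (begin
    f i                       ≡⟨ lookup-index (f∈ i) ⟩
    lookup xs (index (f∈ i))  ≡⟨ cong (lookup xs) same-index ⟩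
    lookup xs (index (f∈ j))  ≡⟨ lookup-index (f∈ j) ⟨
    f j                       ∎)
    where open ≡-Reasoning

module _ (_≟ᴬ_ : DecidableEquality A) where

  injective⇒sublist : ∀ {k} {f : Fin k → A} → Injective _≡_ _≡_ f → (∀ i → f i ∈ xs) →
    ∃ λ ys → ys ⊆ xs × length ys ≡ k × (∀ {y} → y ∈ ys → ∃ λ i → f i ≡ y)
  injective⇒sublist {xs = xs} {k} {f} f-injective f∈ =
    take k image , ⊆-trans (take-⊆ k image) (filter-⊆ in-image? xs) ,
    trans (length-take k image) (m≤n⇒m⊓n≡m k≤length) ,
    λ y∈ → proj₂ (∈-filter⁻ in-image? {xs = xs} (Sublist.lookup (take-⊆ k image) y∈))
    where
    in-image? : Decidable (λ y → ∃ λ i → f i ≡ y)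
    in-image? y = any? (λ i → f i ≟ᴬ y)
    image : List A
    image = filter in-image? xs
    k≤length : k ≤ length image
    k≤length = injective⇒≤length f-injective (λ i → ∈-filter⁺ in-image? (f∈ i) (i , refl))

lookupOr : A → List A → ℕ → A
lookupOr d []       _       = d
lookupOr d (x ∷ xs) zero    = x
lookupOr d (x ∷ xs) (suc j) = lookupOr d xs j

lookupOr-index : ∀ {d : A} (x∈ : x ∈ xs) → lookupOr d xs (toℕ (index x∈)) ≡ x
lookupOr-index (here refl) = refl
lookupOr-index (there x∈)  = lookupOr-index x∈

All-lookupOr : ∀ {P : A → Set} {d} → P d → All P xs → ∀ j → P (lookupOr d xs j)
All-lookupOr pd []         _       = pd
All-lookupOr pd (px ∷ _)   zero    = px
All-lookupOr pd (_ ∷ pxs)  (suc j) = All-lookupOr pd pxs j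

Colorable-K : ∀ n → Colorable (K n) n
Colorable-K n = id , λ _ _ i≢j → i≢j

Colorable-KBip : ∀ a b → Colorable (KBip a b) 2
Colorable-KBip a b = side , proper
  where
  side : Fin a ⊎ Fin b → Fin 2
  side (inj₁ _) = Fin.zero
  side (inj₂ _) = Fin.suc Fin.zero
  proper : Proper (KBip a b) side
  proper (inj₁ _) (inj₁ _) ()
  proper (inj₁ _) (inj₂ _) _ ()
  proper (inj₂ _) (inj₁ _) _ ()
  proper (inj₂ _) (inj₂ _) ()

join-injective : ∀ m n {u v : Fin m ⊎ Fin n} → join m n u ≡ join m n v → u ≡ v
join-injective m n {u} {v} same = begin
  u                      ≡⟨ splitAt-join m n u ⟨
  splitAt m (join m n u) ≡⟨ cong (splitAt m) same ⟩
  splitAt m (join m n v) ≡⟨ splitAt-join m n v ⟩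
  v                      ∎
  where open ≡-Reasoning

Colorable-∨ : ∀ {G H m n} → Colorable G m → Colorable H n → Colorable (G ∨G H) (m + n)
Colorable-∨ {G} {H} {m} {n} (c , c-proper) (d , d-proper) = join m n ∘ Sum.map c d , proper
  where
  proper : Proper (G ∨G H) (join m n ∘ Sum.map c d)
  proper (inj₁ x) (inj₁ y) xy same = c-proper x y xy (inj₁-injective (join-injective m n same))
  proper (inj₁ x) (inj₂ y) _  same = contradiction (join-injective m n {inj₁ (c x)} {inj₂ (d y)} same) λ ()
  proper (inj₂ x) (inj₁ y) _  same = contradiction (join-injective m n {inj₂ (d x)} {inj₁ (c y)} same) λ ()
  proper (inj₂ x) (inj₂ y) xy same = d-proper x y xy (inj₂-injective (join-injective m n same))

Proper⇒injective-on-clique : ∀ {G : Graph} {X : Set} {n} {c : V G → X} → Proper G c →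
  (q : Fin n → V G) → (∀ {i j} → i ≢ j → Adj G (q i) (q j)) → Injective _≡_ _≡_ (c ∘ q)
Proper⇒injective-on-clique c-proper q q-clique {i} {j} same =
  decidable-stable (i Fin.≟ j) (λ i≢j → c-proper (q i) (q j) (q-clique i≢j) same)

Choosable-mono : ∀ {G k l} → k ≤ l → Choosable G k → Choosable G l
Choosable-mono {G} {k} k≤l k-choosable L L-unique L-length =
  widen (k-choosable (take k ∘ L) (λ v → Unique.take⁺ k (L-unique v)) length-take-k)
  where
  widen : Σ (V G → ℕ) (λ c → (∀ v → c v ∈ take k (L v)) × Proper G c) →
          Σ (V G → ℕ) (λ c → (∀ v → c v ∈ L v) × Proper G c)
  widen (c , c∈ , c-proper) = c , (λ v → Sublist.lookup (take-⊆ k (L v)) (c∈ v)) , c-proper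
  length-take-k : ∀ v → length (take k (L v)) ≡ k
  length-take-k v = trans (length-take k (L v)) (m≤n⇒m⊓n≡m (subst (k ≤_) (sym (L-length v)) k≤l))

GapAtMost⇒Choosable : ∀ {G s k} → GapAtMost G s → Colorable G k → Choosable G (k + s)
GapAtMost⇒Choosable {G} {s} {k}
  (ℓ , χ , (ℓ-choosable , _) , (_ , uncolorable-below-χ) , ℓ≤χ+s) k-colorable =
  Choosable-mono {G} (≤-trans ℓ≤χ+s (+-monoˡ-≤ s χ≤k)) ℓ-choosable
  where
  χ≤k : χ ≤ k
  χ≤k = ≮⇒≥ λ k<χ → uncolorable-below-χ k k<χ k-colorable

block : ℕ → ℕ → List ℕ
block n k = applyUpTo (k * n +_) n

length-block : ∀ n k → length (block n k) ≡ n
length-block n k = length-applyUpTo (k * n +_) n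

block-unique : ∀ n k → Unique (block n k)
block-unique n k = Unique.applyUpTo⁺₁ (k * n +_) n λ i<j _ → <⇒≢ i<j ∘ +-cancelˡ-≡ (k * n) _ _

∈-block⇒/≡ : ∀ n .{{_ : NonZero n}} k {x} → x ∈ block n k → x / n ≡ k
∈-block⇒/≡ n k x∈ with i , i<n , refl ← ∈-applyUpTo⁻ (k * n +_) x∈ = begin
    (k * n + i) / n     ≡⟨ +-distrib-/-∣ˡ i (n∣m*n k) ⟩
    k * n / n + i / n   ≡⟨ cong₂ _+_ (m*n/n≡m k n) (m<n⇒m/n≡0 i<n) ⟩
    k + 0               ≡⟨ +-identityʳ k ⟩
    k                   ∎
  where open ≡-Reasoning

block-disjoint : ∀ n .{{_ : NonZero n}} {k l} → k ≢ l → Disjoint (block n k) (block n l)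
block-disjoint n {k} {l} k≢l (x∈k , x∈l) = k≢l (trans (sym (∈-block⇒/≡ n k x∈k)) (∈-block⇒/≡ n l x∈l))

module BadListAssignment (t m b : ℕ) where

  N : ℕ
  N = suc t + m

  G : Graph
  G = K t ∨G KBip (suc m) b

  small : Fin (suc m) → V G
  small = inj₂ ∘ inj₁

  big : Fin b → V G
  big = inj₂ ∘ inj₂

  S : List ℕ
  S = block N 0

  T : Fin m → List ℕ
  T i = block N (suc (toℕ i))

  Ts : List (List ℕ)
  Ts = tabulate T

  bigSideLists : List (List ℕ)
  bigSideLists = cartesianProductWith _++_ (combinations (suc t) S) (choices Ts)

  lists : V G → List ℕ
  lists (inj₁ _)        = S
  lists (inj₂ (inj₁ i)) = block N (toℕ i)
  lists (inj₂ (inj₂ j)) = lookupOr S bigSideLists (toℕ j)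

  Palette : List ℕ → Set
  Palette xs = Unique xs × length xs ≡ N

  block-palette : ∀ k → Palette (block N k)
  block-palette k = block-unique N k , length-block N k

  blocks-disjoint : AllPairs Disjoint (S ∷ Ts)
  blocks-disjoint = AllPairsₚ.tabulate⁺ {f = λ (i : Fin (suc m)) → block N (toℕ i)}
                                        λ i≢j → block-disjoint N (i≢j ∘ toℕ-injective)

  ++-palette : ∀ {D gs} → D ⊆ S → length D ≡ suc t → Pointwise _∈_ gs Ts → Palette (D ++ gs)
  ++-palette {D} {gs} D⊆S |D|≡1+t gs∈Ts with S-disjoint ∷ Ts-disjoint ← blocks-disjoint =
    Unique.++⁺ (Unique-anti-mono D⊆S (block-unique N 0)) (Pointwise-∈⇒Unique gs∈Ts Ts-disjoint) D∩gs≡∅ ,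
    (begin
      length (D ++ gs)       ≡⟨ length-++ D ⟩
      length D + length gs   ≡⟨ cong₂ _+_ |D|≡1+t (trans (Pointwise-length gs∈Ts) (length-tabulate T)) ⟩
      suc t + m              ∎)
    where
    open ≡-Reasoning
    D∩gs≡∅ : Disjoint D gs
    D∩gs≡∅ (x∈D , x∈gs) = All.lookup (Pointwise-∈⇒All-∉ gs∈Ts S-disjoint) x∈gs (Sublist.lookup D⊆S x∈D)

  bigSideLists-palettes : All Palette bigSideLists
  bigSideLists-palettes = All.tabulate palette
    where
    palette : ∀ {v} → v ∈ bigSideLists → Palette v
    palette v∈
      with D , gs , D∈ , gs∈ , refl ← ∈-cartesianProductWith⁻ _++_ (combinations (suc t) S) (choices Ts) v∈
      with D⊆S , |D|≡1+t ← ∈-combinations⁻ (suc t) S D∈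
      = ++-palette D⊆S |D|≡1+t (∈-choices⁻ Ts gs∈)

  lists-palettes : ∀ v → Palette (lists v)
  lists-palettes (inj₁ _)        = block-palette 0
  lists-palettes (inj₂ (inj₁ i)) = block-palette (toℕ i)
  lists-palettes (inj₂ (inj₂ j)) = All-lookupOr (block-palette 0) bigSideLists-palettes (toℕ j)

  length-bigSideLists : length bigSideLists ≡ (N C m) * N ^ m
  length-bigSideLists = begin
      length bigSideLists
    ≡⟨ length-cartesianProductWith _++_ (combinations (suc t) S) (choices Ts) ⟩
      length (combinations (suc t) S) * length (choices Ts)
    ≡⟨ cong₂ _*_ (trans (length-combinations (suc t) S) (cong (_C suc t) (length-block N 0)))
                 (length-choices (Allₚ.tabulate⁺ {f = T} λ i → length-block N (suc (toℕ i)))) ⟩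
      (N C suc t) * N ^ length Ts
    ≡⟨ cong₂ (λ a e → a * N ^ e) N-C-1+t≡N-C-m (length-tabulate T) ⟩
      (N C m) * N ^ m
    ∎
    where
    open ≡-Reasoning
    N-C-1+t≡N-C-m : N C suc t ≡ N C m
    N-C-1+t≡N-C-m = trans (nCk≡nC[n∸k] (m≤m+n (suc t) m)) (cong (N C_) (m+n∸m≡n (suc t) m))

  clique : Fin (suc t) → V G
  clique Fin.zero    = small Fin.zero
  clique (Fin.suc i) = inj₁ i

  clique-adjacent : ∀ {i j} → i ≢ j → Adj G (clique i) (clique j)
  clique-adjacent {Fin.zero}  {Fin.zero}  0≢0 = 0≢0 refl
  clique-adjacent {Fin.zero}  {Fin.suc _} _   = tt
  clique-adjacent {Fin.suc _} {Fin.zero}  _   = tt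
  clique-adjacent {Fin.suc _} {Fin.suc _} i≢j = i≢j ∘ cong Fin.suc

  clique-adjacent-big : ∀ i j → Adj G (clique i) (big j)
  clique-adjacent-big Fin.zero    _ = tt
  clique-adjacent-big (Fin.suc _) _ = tt

  clique-lists : ∀ i → lists (clique i) ≡ S
  clique-lists Fin.zero    = refl
  clique-lists (Fin.suc _) = refl

  not-choosable : length bigSideLists ≤ b → ¬ Choosable G N
  not-choosable |bigSideLists|≤b N-choosable
    with c , c∈ , c-proper ← N-choosable lists (proj₁ ∘ lists-palettes) (proj₂ ∘ lists-palettes)
    with D , D⊆S , |D|≡1+t , D⊆clique-colours ← injective⇒sublist _≟_
           (Proper⇒injective-on-clique {G} c-proper clique clique-adjacent)
           (λ i → subst (c (clique i) ∈_) (clique-lists i) (c∈ (clique i)))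
    = uncolorable (∈-++⁻ D (subst (c (big j) ∈_) lists-big-j≡D++gs (c∈ (big j))))
    where
    gs : List ℕ
    gs = tabulate (c ∘ small ∘ Fin.suc)
    D++gs∈bigSideLists : D ++ gs ∈ bigSideLists
    D++gs∈bigSideLists = ∈-cartesianProductWith⁺ _++_
      (subst (λ k → D ∈ combinations k S) |D|≡1+t (∈-combinations⁺ D⊆S))
      (∈-choices⁺ (Pointwise.tabulate⁺ (c∈ ∘ small ∘ Fin.suc)))
    j : Fin b
    j = inject≤ (index D++gs∈bigSideLists) |bigSideLists|≤b
    lists-big-j≡D++gs : lists (big j) ≡ D ++ gs
    lists-big-j≡D++gs = trans (cong (lookupOr S bigSideLists) (toℕ-inject≤ _ |bigSideLists|≤b))
                              (lookupOr-index D++gs∈bigSideLists)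
    uncolorable : ¬ (c (big j) ∈ D ⊎ c (big j) ∈ gs)
    uncolorable (inj₁ ∈D) with i , same ← D⊆clique-colours ∈D =
      c-proper (clique i) (big j) (clique-adjacent-big i j) same
    uncolorable (inj₂ ∈gs) with i , same ← ∈-tabulate⁻ ∈gs =
      c-proper (small (Fin.suc i)) (big j) tt (sym same)

K∨KBip-notChoosable : ∀ t m b → ((suc t + m) C m) * (suc t + m) ^ m ≤ b →
  ¬ Choosable (K t ∨G KBip (suc m) b) (suc t + m)
K∨KBip-notChoosable t m b bound = not-choosable (subst (_≤ b) (sym length-bigSideLists) bound)
  where open BadListAssignment t m b

corollary7 : (s b : ℕ) → s + 2 ≤ b → (s + 1) ^ (2 * s + 2) ≤ (s + 1) ! * b →
    (r t : ℕ) → IsFloorRoot (2 * s + 2) ((s + 1) ! * b) r → IsTau s (s + 2) b t →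
    r ∸ s ∸ 1 ≤ t
corollary7 s b _ _ r t (r^[2s+2]≤[s+1]!b , _) (gap , _) = begin
    r ∸ s ∸ 1     ≡⟨ ∸-+-assoc r s 1 ⟩
    r ∸ (s + 1)   ≡⟨ cong (r ∸_) (+-comm s 1) ⟩
    r ∸ suc s     ≤⟨ m≤n+o⇒m∸n≤o r (suc s) (subst (r ≤_) (+-comm t (suc s)) (s≤s⁻¹ r<N)) ⟩
    t             ∎
  where
  open ≤-Reasoning
  N : ℕ
  N = suc t + suc s
  N-choosable : Choosable (K t ∨G KBip (suc (suc s)) b) N
  N-choosable = subst₂ (λ a k → Choosable (K t ∨G KBip a b) k)
    (+-comm s 2) (trans (+-assoc t 2 s) (+-suc t (suc s)))
    (GapAtMost⇒Choosable {K t ∨G KBip (s + 2) b} gap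
      (Colorable-∨ (Colorable-K t) (Colorable-KBip (s + 2) b)))
  N^[2s+2]≤[s+1]!b : N ≤ r → N ^ (suc s + suc s) ≤ suc s ! * b
  N^[2s+2]≤[s+1]!b N≤r = begin
    N ^ (suc s + suc s)   ≤⟨ ^-monoˡ-≤ (suc s + suc s) N≤r ⟩
    r ^ (suc s + suc s)   ≡⟨ cong (r ^_)
                               (solve 1 (λ s → (con 1 :+ s) :+ (con 1 :+ s) := con 2 :* s :+ con 2) refl s) ⟩
    r ^ (2 * s + 2)       ≤⟨ r^[2s+2]≤[s+1]!b ⟩
    (s + 1) ! * b         ≡⟨ cong (λ k → k ! * b) (+-comm s 1) ⟩
    suc s ! * b           ∎
    where open +-*-Solver
  r<N : r < N
  r<N = ≰⇒> λ N≤r → K∨KBip-notChoosable t (suc s) b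
    (n^[k+k]≤k!*b⇒nCk*n^k≤b N (suc s) b (N^[2s+2]≤[s+1]!b N≤r)) N-choosable
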